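{- Let $A$ be a pseudo-BCI algebra and let $d_1,d_2$ be regular type II implicative derivations on $A$ such that $d_2\circ d_2=d_2$ and $d_1(x)\le d_2(x)$ for all $x\in A$. Then $d_2\circ d_1=d_2$.
   Context: A pseudo-BCI algebra is a structure $(A,\to,\rightsquigarrow,1)$ of type $(2,2,0)$ such that for all $x,y,z\in A$: $(x\to y)\rightsquigarrow[(y\to z)\rightsquigarrow(x\to z)]=1$; $(x\rightsquigarrow y)\to[(y\rightsquigarrow z)\to(x\rightsquigarrow z)]=1$; $1\to x=x$; $1\rightsquigarrow x=x$; and $x\to y=1$, $y\to x=1$ imply $x=y$. Write $x\le y$ iff $x\to y=1$. Put $x\Cup_1 y=(x\to y)\rightsquigarrow y$ and $x\Cup_2 y=(x\rightsquigarrow y)\to y$. A map $d:A\to A$ is a type II implicative derivation if $d(x\to y)=(d(x)\to y)\Cup_2(x\to d(y))$ and $d(x\rightsquigarrow y)=(d(x)\rightsquigarrow y)\Cup_1(x\rightsquigarrow d(y))$ for all $x,y$; it is regular if $d(1)=1$. -}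

module Defs where

open import Level using (Level; suc)
open import Relation.Binary.PropositionalEquality using (_≡_)
open import Data.Product using (_×_)

record PseudoBCI (a : Level) : Set (suc a) where
  infixr 25 _⇒_ _⇝_
  field
    Carrier : Set a
    _⇒_     : Carrier → Carrier → Carrier
    _⇝_     : Carrier → Carrier → Carrier
    𝟙       : Carrier
    ax1 : ∀ x y z → ((x ⇒ y) ⇝ ((y ⇒ z) ⇝ (x ⇒ z))) ≡ 𝟙
    ax2 : ∀ x y z → ((x ⇝ y) ⇒ ((y ⇝ z) ⇒ (x ⇝ z))) ≡ 𝟙
    ax3 : ∀ x → (𝟙 ⇒ x) ≡ x
    ax4 : ∀ x → (𝟙 ⇝ x) ≡ x
    ax5 : ∀ x y → (x ⇒ y) ≡ 𝟙 → (y ⇒ x) ≡ 𝟙 → x ≡ y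

  _≤_ : Carrier → Carrier → Set a
  x ≤ y = (x ⇒ y) ≡ 𝟙

  _⋓₁_ : Carrier → Carrier → Carrier
  x ⋓₁ y = (x ⇒ y) ⇝ y

  _⋓₂_ : Carrier → Carrier → Carrier
  x ⋓₂ y = (x ⇝ y) ⇒ y

module _ {a : Level} (A : PseudoBCI a) where
  open PseudoBCI A

  IsTypeIIImplicativeDerivation : (Carrier → Carrier) → Set a
  IsTypeIIImplicativeDerivation d =
    (∀ x y → d (x ⇒ y) ≡ ((d x ⇒ y) ⋓₂ (x ⇒ d y))) ×
    (∀ x y → d (x ⇝ y) ≡ ((d x ⇝ y) ⋓₁ (x ⇝ d y)))

  IsRegular : (Carrier → Carrier) → Set a
  IsRegular d = d 𝟙 ≡ 𝟙

module Submission where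

-- A regular type II implicative derivation d is inflationary, and because d(a → b) and
-- d(a ⇝ b) are joins of comparable elements it passes through the second argument of
-- both implications: d(a → b) = a → d b and d(a ⇝ b) = a ⇝ d b. Applied to d x ⇝ x
-- this forces d x = (d x ⇝ x) → x, and dually d x = (d x → x) ⇝ x. With the exchange
-- law a → (b ⇝ c) = b ⇝ (a → c) these two representations show that any two such
-- derivations commute. Hence d₂ (d₁ x) = d₁ (d₂ x), which is squeezed between
-- d₂ x ≤ d₁ (d₂ x) and d₁ (d₂ x) ≤ d₂ (d₂ x) = d₂ x.

open import Defs
open import Level using (Level)
open import Data.Product using (proj₁; proj₂)
open import Relation.Binary.PropositionalEquality
  using (_≡_; sym; trans; cong; cong₂; module ≡-Reasoning)

module PseudoBCIProperties {a : Level} (A : PseudoBCI a) where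
  open PseudoBCI A
  open ≡-Reasoning

  ≤-antisym : ∀ {x y} → x ≤ y → y ≤ x → x ≡ y
  ≤-antisym = ax5 _ _

  ≤-refl : ∀ x → x ≤ x
  ≤-refl x = begin
    x ⇒ x                           ≡⟨ sym (ax3 (x ⇒ x)) ⟩
    𝟙 ⇒ (x ⇒ x)                     ≡⟨ sym (cong₂ _⇒_ (ax4 𝟙) (cong₂ _⇒_ (ax4 x) (ax4 x))) ⟩
    (𝟙 ⇝ 𝟙) ⇒ ((𝟙 ⇝ x) ⇒ (𝟙 ⇝ x))   ≡⟨ ax2 𝟙 𝟙 x ⟩
    𝟙                               ∎

  ≤-⋓₂ : ∀ x y → x ≤ (x ⋓₂ y)
  ≤-⋓₂ x y = trans (sym (cong₂ _⇒_ (ax4 x) (cong ((x ⇝ y) ⇒_) (ax4 y)))) (ax2 𝟙 x y)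

  ⇝-⋓₁≡𝟙 : ∀ x y → x ⇝ (x ⋓₁ y) ≡ 𝟙
  ⇝-⋓₁≡𝟙 x y = trans (sym (cong₂ _⇝_ (ax3 x) (cong ((x ⇒ y) ⇝_) (ax3 y)))) (ax1 𝟙 x y)

  ≤⇒⇝≡𝟙 : ∀ {x y} → x ≤ y → x ⇝ y ≡ 𝟙
  ≤⇒⇝≡𝟙 {x} {y} x≤y = begin
    x ⇝ y              ≡⟨ cong (x ⇝_) (sym (ax4 y)) ⟩
    x ⇝ (𝟙 ⇝ y)        ≡⟨ cong (λ u → x ⇝ (u ⇝ y)) (sym x≤y) ⟩
    x ⇝ (x ⋓₁ y)       ≡⟨ ⇝-⋓₁≡𝟙 x y ⟩
    𝟙                  ∎

  ⇝≡𝟙⇒≤ : ∀ {x y} → x ⇝ y ≡ 𝟙 → x ≤ y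
  ⇝≡𝟙⇒≤ {x} {y} x⇝y≡𝟙 = begin
    x ⇒ y              ≡⟨ cong (x ⇒_) (sym (ax3 y)) ⟩
    x ⇒ (𝟙 ⇒ y)        ≡⟨ cong (λ u → x ⇒ (u ⇒ y)) (sym x⇝y≡𝟙) ⟩
    x ⇒ (x ⋓₂ y)       ≡⟨ ≤-⋓₂ x y ⟩
    𝟙                  ∎

  ≤-⋓₁ : ∀ x y → x ≤ (x ⋓₁ y)
  ≤-⋓₁ x y = ⇝≡𝟙⇒≤ (⇝-⋓₁≡𝟙 x y)

  ≤-trans : ∀ {x y z} → x ≤ y → y ≤ z → x ≤ z
  ≤-trans {x} {y} {z} x≤y y≤z = begin
    x ⇒ z                              ≡⟨ sym (ax4 _) ⟩
    𝟙 ⇝ (x ⇒ z)                        ≡⟨ cong (𝟙 ⇝_) (sym (ax4 _)) ⟩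
    𝟙 ⇝ (𝟙 ⇝ (x ⇒ z))                  ≡⟨ sym (cong₂ (λ u v → u ⇝ (v ⇝ (x ⇒ z))) x≤y y≤z) ⟩
    (x ⇒ y) ⇝ ((y ⇒ z) ⇝ (x ⇒ z))      ≡⟨ ax1 x y z ⟩
    𝟙                                  ∎

  ⇒-antitoneˡ : ∀ {x y} z → x ≤ y → (y ⇒ z) ≤ (x ⇒ z)
  ⇒-antitoneˡ {x} {y} z x≤y = ⇝≡𝟙⇒≤ (begin
    (y ⇒ z) ⇝ (x ⇒ z)                  ≡⟨ sym (ax4 _) ⟩
    𝟙 ⇝ ((y ⇒ z) ⇝ (x ⇒ z))            ≡⟨ cong (_⇝ ((y ⇒ z) ⇝ (x ⇒ z))) (sym x≤y) ⟩
    (x ⇒ y) ⇝ ((y ⇒ z) ⇝ (x ⇒ z))      ≡⟨ ax1 x y z ⟩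
    𝟙                                  ∎)

  ⇝-antitoneˡ : ∀ {x y} z → x ≤ y → (y ⇝ z) ≤ (x ⇝ z)
  ⇝-antitoneˡ {x} {y} z x≤y = begin
    (y ⇝ z) ⇒ (x ⇝ z)                  ≡⟨ sym (ax3 _) ⟩
    𝟙 ⇒ ((y ⇝ z) ⇒ (x ⇝ z))            ≡⟨ cong (_⇒ ((y ⇝ z) ⇒ (x ⇝ z))) (sym (≤⇒⇝≡𝟙 x≤y)) ⟩
    (x ⇝ y) ⇒ ((y ⇝ z) ⇒ (x ⇝ z))      ≡⟨ ax2 x y z ⟩
    𝟙                                  ∎

  ⇒-monotoneʳ : ∀ x {y z} → y ≤ z → (x ⇒ y) ≤ (x ⇒ z)
  ⇒-monotoneʳ x {y} {z} y≤z = ⇝≡𝟙⇒≤ (begin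
    (x ⇒ y) ⇝ (x ⇒ z)                  ≡⟨ cong ((x ⇒ y) ⇝_) (sym (ax4 _)) ⟩
    (x ⇒ y) ⇝ (𝟙 ⇝ (x ⇒ z))            ≡⟨ cong (λ u → (x ⇒ y) ⇝ (u ⇝ (x ⇒ z))) (sym y≤z) ⟩
    (x ⇒ y) ⇝ ((y ⇒ z) ⇝ (x ⇒ z))      ≡⟨ ax1 x y z ⟩
    𝟙                                  ∎)

  ⇝-monotoneʳ : ∀ x {y z} → y ≤ z → (x ⇝ y) ≤ (x ⇝ z)
  ⇝-monotoneʳ x {y} {z} y≤z = begin
    (x ⇝ y) ⇒ (x ⇝ z)                  ≡⟨ cong ((x ⇝ y) ⇒_) (sym (ax3 _)) ⟩
    (x ⇝ y) ⇒ (𝟙 ⇒ (x ⇝ z))            ≡⟨ cong (λ u → (x ⇝ y) ⇒ (u ⇒ (x ⇝ z))) (sym (≤⇒⇝≡𝟙 y≤z)) ⟩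
    (x ⇝ y) ⇒ ((y ⇝ z) ⇒ (x ⇝ z))      ≡⟨ ax2 x y z ⟩
    𝟙                                  ∎

  ⇒-⇝-exchange : ∀ x y z → x ⇒ (y ⇝ z) ≡ y ⇝ (x ⇒ z)
  ⇒-⇝-exchange x y z = ≤-antisym
    (≤-trans (⇝≡𝟙⇒≤ (ax1 x (y ⇝ z) z)) (⇝-antitoneˡ (x ⇒ z) (≤-⋓₂ y z)))
    (≤-trans (ax2 y (x ⇒ z) z) (⇒-antitoneˡ (y ⇝ z) (≤-⋓₁ x z)))

  ⋓₁-⇒≡⇒ : ∀ x y → (x ⋓₁ y) ⇒ y ≡ x ⇒ y
  ⋓₁-⇒≡⇒ x y = ≤-antisym (⇒-antitoneˡ y (≤-⋓₁ x y)) (≤-⋓₂ (x ⇒ y) y)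

  ⋓₂-⇝≡⇝ : ∀ x y → (x ⋓₂ y) ⇝ y ≡ x ⇝ y
  ⋓₂-⇝≡⇝ x y = ≤-antisym (⇝-antitoneˡ y (≤-⋓₂ x y)) (≤-⋓₁ (x ⇝ y) y)

  ≤⇒⋓₁≡ʳ : ∀ {x y} → x ≤ y → x ⋓₁ y ≡ y
  ≤⇒⋓₁≡ʳ {x} {y} x≤y = trans (cong (_⇝ y) x≤y) (ax4 y)

  ≤⇒⋓₂≡ʳ : ∀ {x y} → x ≤ y → x ⋓₂ y ≡ y
  ≤⇒⋓₂≡ʳ {x} {y} x≤y = trans (cong (_⇒ y) (≤⇒⇝≡𝟙 x≤y)) (ax3 y)

  module RegularTypeIIDerivation
    (d : Carrier → Carrier) (isDer : IsTypeIIImplicativeDerivation A d) (regular : IsRegular A d)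
    where

    d-⇒-⋓₂ : ∀ x y → d (x ⇒ y) ≡ ((d x ⇒ y) ⋓₂ (x ⇒ d y))
    d-⇒-⋓₂ = proj₁ isDer

    d-⇝-⋓₁ : ∀ x y → d (x ⇝ y) ≡ ((d x ⇝ y) ⋓₁ (x ⇝ d y))
    d-⇝-⋓₁ = proj₂ isDer

    inflationary : ∀ x → x ≤ d x
    inflationary x = trans (cong (x ⇒_) dx≡x⋓₂dx) (≤-⋓₂ x (d x))
      where
      dx≡x⋓₂dx : d x ≡ (x ⋓₂ d x)
      dx≡x⋓₂dx = begin
        d x                                  ≡⟨ cong d (sym (ax3 x)) ⟩
        d (𝟙 ⇒ x)                            ≡⟨ d-⇒-⋓₂ 𝟙 x ⟩
        (d 𝟙 ⇒ x) ⋓₂ (𝟙 ⇒ d x)               ≡⟨ cong₂ _⋓₂_ (trans (cong (_⇒ x) regular) (ax3 x)) (ax3 (d x)) ⟩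
        x ⋓₂ d x                             ∎

    d-⇒ : ∀ x y → d (x ⇒ y) ≡ x ⇒ d y
    d-⇒ x y = trans (d-⇒-⋓₂ x y)
      (≤⇒⋓₂≡ʳ (≤-trans (⇒-antitoneˡ y (inflationary x)) (⇒-monotoneʳ x (inflationary y))))

    d-⇝ : ∀ x y → d (x ⇝ y) ≡ x ⇝ d y
    d-⇝ x y = trans (d-⇝-⋓₁ x y)
      (≤⇒⋓₁≡ʳ (≤-trans (⇝-antitoneˡ y (inflationary x)) (⇝-monotoneʳ x (inflationary y))))

    dx≡dx⋓₂x : ∀ x → d x ≡ (d x ⋓₂ x)
    dx≡dx⋓₂x x = ≤-antisym (≤-⋓₂ (d x) x) (⇝≡𝟙⇒≤ (begin
      (d x ⋓₂ x) ⇝ d x                       ≡⟨ sym (d-⇝ (d x ⋓₂ x) x) ⟩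
      d ((d x ⋓₂ x) ⇝ x)                     ≡⟨ cong d (⋓₂-⇝≡⇝ (d x) x) ⟩
      d (d x ⇝ x)                            ≡⟨ d-⇝ (d x) x ⟩
      d x ⇝ d x                              ≡⟨ ≤⇒⇝≡𝟙 (≤-refl (d x)) ⟩
      𝟙                                      ∎))

    dx≡dx⋓₁x : ∀ x → d x ≡ (d x ⋓₁ x)
    dx≡dx⋓₁x x = ≤-antisym (≤-⋓₁ (d x) x) (begin
      (d x ⋓₁ x) ⇒ d x                       ≡⟨ sym (d-⇒ (d x ⋓₁ x) x) ⟩
      d ((d x ⋓₁ x) ⇒ x)                     ≡⟨ cong d (⋓₁-⇒≡⇒ (d x) x) ⟩
      d (d x ⇒ x)                            ≡⟨ d-⇒ (d x) x ⟩
      d x ⇒ d x                              ≡⟨ ≤-refl (d x) ⟩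
      𝟙                                      ∎)

  regularTypeIIDerivations-commute :
    (f g : Carrier → Carrier) →
    IsTypeIIImplicativeDerivation A f → IsRegular A f →
    IsTypeIIImplicativeDerivation A g → IsRegular A g →
    ∀ x → g (f x) ≡ f (g x)
  regularTypeIIDerivations-commute f g isDerF regF isDerG regG x = begin
    g (f x)                                  ≡⟨ cong g (F.dx≡dx⋓₁x x) ⟩
    g ((f x ⇒ x) ⇝ x)                        ≡⟨ G.d-⇝ (f x ⇒ x) x ⟩
    (f x ⇒ x) ⇝ g x                          ≡⟨ cong ((f x ⇒ x) ⇝_) (G.dx≡dx⋓₂x x) ⟩
    (f x ⇒ x) ⇝ ((g x ⇝ x) ⇒ x)              ≡⟨ sym (⇒-⇝-exchange (g x ⇝ x) (f x ⇒ x) x) ⟩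
    (g x ⇝ x) ⇒ ((f x ⇒ x) ⇝ x)              ≡⟨ cong ((g x ⇝ x) ⇒_) (sym (F.dx≡dx⋓₁x x)) ⟩
    (g x ⇝ x) ⇒ f x                          ≡⟨ sym (F.d-⇒ (g x ⇝ x) x) ⟩
    f ((g x ⇝ x) ⇒ x)                        ≡⟨ cong f (sym (G.dx≡dx⋓₂x x)) ⟩
    f (g x)                                  ∎
    where
    module F = RegularTypeIIDerivation f isDerF regF
    module G = RegularTypeIIDerivation g isDerG regG

  fixedPoint-of-dominating-idempotent :
    (f g : Carrier → Carrier) →
    IsTypeIIImplicativeDerivation A f → IsRegular A f →
    (∀ x → g (g x) ≡ g x) → (∀ x → f x ≤ g x) →
    ∀ x → f (g x) ≡ g x
  fixedPoint-of-dominating-idempotent f g isDerF regF idem f≤g x = ≤-antisym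
    (trans (cong (f (g x) ⇒_) (sym (idem x))) (f≤g (g x)))
    (RegularTypeIIDerivation.inflationary f isDerF regF (g x))

proposition3p13 : {a : Level} (A : PseudoBCI a) →
    (d₁ d₂ : PseudoBCI.Carrier A → PseudoBCI.Carrier A) →
    IsTypeIIImplicativeDerivation A d₁ → IsRegular A d₁ →
    IsTypeIIImplicativeDerivation A d₂ → IsRegular A d₂ →
    (∀ x → d₂ (d₂ x) ≡ d₂ x) →
    (∀ x → PseudoBCI._≤_ A (d₁ x) (d₂ x)) →
    ∀ x → d₂ (d₁ x) ≡ d₂ x
proposition3p13 A d₁ d₂ isDer₁ reg₁ isDer₂ reg₂ idem d₁≤d₂ x =
  trans (regularTypeIIDerivations-commute d₁ d₂ isDer₁ reg₁ isDer₂ reg₂ x)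
        (fixedPoint-of-dominating-idempotent d₁ d₂ isDer₁ reg₁ idem d₁≤d₂ x)
  where open PseudoBCIProperties A
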